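{- Let $D$ be a semicomplete multipartite digraph. Suppose that $P^g=u_1u_2\cdots u_r$ is a G-path of $D$ and $C^g$ is a G-cycle in $D-V(P^g)$. Suppose that for each $i\in[r-1]$, either the G-path $u_i$ (a single vertex) or the G-path $u_iu_{i+1}$ has a partner on $C^g$, and that $u_r$ has a partner on $C^g$. Then $D$ has a G-cycle with vertex set $V(P^g)\cup V(C^g)$ and at least $\ell(P^g)+\ell(C^g)+1$ arcs.
   Context: All digraphs are finite, without loops or parallel arcs (2-cycles allowed). A digraph $D$ is a semicomplete multipartite digraph if $V(D)$ has a partition into nonempty sets (partite sets) such that no arc has both ends in the same set and any two vertices in different partite sets are joined by at least one arc. A G-path of $D$ is a sequence of $r\ge1$ pairwise vertex-disjoint directed paths $P_1,\ldots,P_r$ (a path may be a single vertex), $P_i$ from $u_i$ to $v_i$, with $v_i$ and $u_{i+1}$ in the same partite set for each $i\in[r-1]$; it is written as the vertex sequence obtained by concatenating $P_1,\ldots,P_r$, and it starts at $u_1$ and ends at $v_r$; thus consecutive vertices in the sequence are either joined by an arc from the earlier to the later, or lie in the same partite set. A G-cycle is either a directed cycle of $D$ or such a sequence of paths for which also $v_r$ and $u_1$ lie in the same partite set; its vertices are cyclically ordered (by following the cycle, resp. concatenating $P_1,\ldots,P_r$ and returning to the start). The length $\ell$ of a G-path or G-cycle is its number of arcs of $D$. For a G-path $Q$ starting at $x$ and ending at $y$ (possibly $x=y$) and a G-cycle $C^g$ vertex-disjoint from $Q$, $Q$ has a partner on $C^g$ if there are vertices $v,v'$ that are consecutive (in this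 order) in the cyclic order of $C^g$ with $v\to x$ and $y\to v'$ being arcs of $D$. For consecutive vertices $u_i,u_{i+1}$ of $P^g$, "$u_iu_{i+1}$" denotes the G-path consisting of these two vertices in this order. -}

module Defs where

open import Data.Nat using (ℕ; zero; suc; _+_; _≤_)
open import Data.Fin using (Fin; zero; suc; inject₁; fromℕ)
open import Data.Bool using (Bool; true; false; T; if_then_else_)
open import Data.Product using (Σ; ∃; _×_; _,_)
open import Data.Sum using (_⊎_)
open import Function using (_∘_)
open import Function.Definitions using (Injective)
open import Relation.Binary.PropositionalEquality using (_≡_; _≢_)

-- Arcs are a Bool-valued relation, so there are
-- no parallel arcs; 2-cycles are allowed.  Loops are excluded because two
-- vertices of the same partite set (in particular u and u) have no arc.
record SMD (n k : ℕ) : Set where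
  field
    arc          : Fin n → Fin n → Bool
    part         : Fin n → Fin k
    part-nonempty : ∀ (j : Fin k) → ∃ λ v → part v ≡ j
    indep        : ∀ u v → part u ≡ part v → arc u v ≡ false
    semicomplete : ∀ u v → part u ≢ part v → T (arc u v) ⊎ T (arc v u)

count : ∀ {m} → (Fin m → Bool) → ℕ
count {zero}  f = 0
count {suc m} f = (if f zero then 1 else 0) + count (f ∘ suc)

csuc : ∀ {m} → Fin (suc m) → Fin (suc m)
csuc {zero}  zero    = zero
csuc {suc m} zero    = suc zero
csuc {suc m} (suc i) = shift (csuc i)
  where
  shift : Fin (suc m) → Fin (suc (suc m))
  shift zero    = zero
  shift (suc j) = suc (suc j)

module _ {n k : ℕ} (D : SMD n k) where
  open SMD D

  Step : Fin n → Fin n → Set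
  Step u v = T (arc u v) ⊎ part u ≡ part v

  IsGPath : ∀ {m} → (Fin (suc m) → Fin n) → Set
  IsGPath {m} p = Injective _≡_ _≡_ p × (∀ (i : Fin m) → Step (p (inject₁ i)) (p (suc i)))

  pathLen : ∀ {m} → (Fin (suc m) → Fin n) → ℕ
  pathLen {m} p = count {m} (λ i → arc (p (inject₁ i)) (p (suc i)))

  IsDirCycle : ∀ {m} → (Fin (suc m) → Fin n) → Set
  IsDirCycle {m} c = Injective _≡_ _≡_ c × 1 ≤ m × (∀ i → T (arc (c i) (c (csuc i))))

  IsGCycle : ∀ {m} → (Fin (suc m) → Fin n) → Set
  IsGCycle {m} c = IsDirCycle c ⊎ (IsGPath c × part (c (fromℕ m)) ≡ part (c zero))

  cycLen : ∀ {m} → (Fin (suc m) → Fin n) → ℕ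
  cycLen {m} c = count {suc m} (λ i → arc (c i) (c (csuc i)))

  HasPartner : ∀ {m} → Fin n → Fin n → (Fin (suc m) → Fin n) → Set
  HasPartner {m} x y c = ∃ λ (i : Fin (suc m)) → T (arc (c i) x) × T (arc y (c (csuc i)))

{-# OPTIONS --safe #-}

-- Write the path and the cycle as vertex lists, a G-path or G-cycle being a list whose
-- consecutive pairs ("links") are all arcs or same-partite pairs. Let (a , b) be the partner
-- link of the first path vertex x, and x' the last path vertex with an arc into b (x or its
-- successor has one). Rotating the cycle so that it ends with the link (a , b) and splicing
-- the segment x … x' in between trades that link for the arcs a → x and x' → b, so the cycle
-- gains at least ℓ(x … x') + 1 arcs. No later path vertex has an arc into b, so the partner
-- links of the remaining path survive, and they are spliced in by induction on the length of
-- the path; each splice pays with its +1 for the link between consecutive segments. Finally a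
-- cyclic list of links is a directed cycle if all links are arcs, and otherwise becomes a
-- G-path closed by a same-partite pair after rotating a non-arc link to the end.

module Submission where

open import Defs
open import Data.Bool using (Bool; true; false; T; if_then_else_)
open import Data.Empty using (⊥-elim)
open import Data.Fin using (Fin; zero; suc; inject₁; fromℕ)
open import Data.List using (List; []; _∷_; _++_; [_]; length; map; tabulate; lookup)
open import Data.List.Properties using (++-assoc; length-++; map-++; tabulate-cong; tabulate-lookup)
open import Data.List.Membership.Propositional using (_∈_; find)
open import Data.List.Membership.Propositional.Properties
  using (∈-++⁺ˡ; ∈-++⁺ʳ; ∈-++⁻; ∈-lookup; ∈-tabulate⁺; ∈-tabulate⁻)
open import Data.List.Relation.Unary.All as All using (All; []; _∷_; all?)
open import Data.List.Relation.Unary.All.Properties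
  using (++⁺; ++⁻; tabulate⁺; tabulate⁻; ¬Any⇒All¬; All¬⇒¬Any; ¬All⇒Any¬)
open import Data.List.Relation.Unary.Any using (Any; here; there; any?; index)
open import Data.List.Relation.Unary.Any.Properties using (lookup-index)
open import Data.List.Relation.Unary.AllPairs using (_∷_)
open import Data.List.Relation.Unary.Unique.Propositional using (Unique)
import Data.List.Relation.Unary.Unique.Propositional.Properties as Unique
open import Data.List.Relation.Binary.Disjoint.Propositional using (Disjoint)
open import Data.List.Relation.Binary.Permutation.Propositional
  using (_↭_; ↭-refl; ↭-sym; ↭-trans; ↭⇒↭ₛ; module PermutationReasoning)
open import Data.List.Relation.Binary.Permutation.Propositional.Properties
  using (++-comm; ++⁺ˡ; shifts; map⁺; ∈-resp-↭; All-resp-↭)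
import Data.List.Relation.Binary.Permutation.Setoid.Properties as SetoidPermutation
open import Data.Nat using (ℕ; zero; suc; _+_; _≤_; _<_; z≤n; s≤s)
open import Data.Nat.Induction using (<-wellFounded)
open import Data.Nat.ListAction using (sum)
open import Data.Nat.ListAction.Properties using (sum-++; sum-↭)
open import Data.Nat.Properties
  using (+-comm; +-identityʳ; +-monoˡ-≤; +-monoʳ-≤; m≤n+m; n<1+n; module ≤-Reasoning)
open import Data.Nat.Tactic.RingSolver using (solve-∀)
open import Data.Product using (∃; ∃₂; ∃-syntax; Σ; _×_; _,_; proj₁; uncurry)
open import Data.Sum using (_⊎_; inj₁; inj₂; [_,_]′)
import Data.Sum as Sum
open import Data.Sum.Function.Propositional using (_⊎-⇔_)
open import Function using (_∘_)
open import Function.Bundles using (_⇔_; mk⇔)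
import Function.Properties.Equivalence as ⇔
open import Function.Definitions using (Injective)
open import Induction.WellFounded using (Acc; acc)
open import Relation.Nullary using (¬_; yes; no)
open import Relation.Nullary.Decidable using (T?)
open import Relation.Unary using (Decidable)
open import Relation.Binary.PropositionalEquality
  using (_≡_; _≢_; refl; sym; trans; cong; cong₂; subst; subst₂; setoid; module ≡-Reasoning)

csuc-inject₁ : ∀ {m} (i : Fin m) → csuc (inject₁ i) ≡ suc i
csuc-inject₁ {suc m} zero    = refl
csuc-inject₁ {suc m} (suc i) rewrite csuc-inject₁ i = refl

csuc-fromℕ : ∀ m → csuc (fromℕ m) ≡ zero
csuc-fromℕ zero    = refl
csuc-fromℕ (suc m) rewrite csuc-fromℕ m = refl

tabulate-∷ʳ : ∀ {B : Set} {m} (g : Fin (suc m) → B) →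
              tabulate g ≡ tabulate (g ∘ inject₁) ++ [ g (fromℕ m) ]
tabulate-∷ʳ {m = zero}  g = refl
tabulate-∷ʳ {m = suc m} g = cong (g zero ∷_) (tabulate-∷ʳ (g ∘ suc))

module _ {A : Set} where

  last : A → List A → A
  last x []       = x
  last _ (y ∷ ys) = last y ys

  links : A → List A → List (A × A)
  links x []       = []
  links x (y ∷ ys) = (x , y) ∷ links y ys

  cyclicLinks : A → List A → List (A × A)
  cyclicLinks x xs = links x (xs ++ [ x ])

  last-++ : ∀ x ys y zs → last x (ys ++ y ∷ zs) ≡ last y zs
  last-++ x []       y zs = refl
  last-++ x (w ∷ ys) y zs = last-++ w ys y zs

  links-++ : ∀ x ys zs → links x (ys ++ zs) ≡ links x ys ++ links (last x ys) zs
  links-++ x []       zs = refl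
  links-++ x (y ∷ ys) zs = cong ((x , y) ∷_) (links-++ y ys zs)

  links-∷ʳ : ∀ x ys y → links x (ys ++ [ y ]) ≡ links x ys ++ [ (last x ys , y) ]
  links-∷ʳ x ys y = links-++ x ys [ y ]

  cyclicLinks-++ : ∀ x ys y zs →
                   cyclicLinks x (ys ++ y ∷ zs) ≡ links x (ys ++ [ y ]) ++ links y (zs ++ [ x ])
  cyclicLinks-++ x ys y zs = begin
    links x ((ys ++ y ∷ zs) ++ [ x ])
      ≡⟨ cong (links x) (trans (++-assoc ys (y ∷ zs) [ x ]) (sym (++-assoc ys [ y ] (zs ++ [ x ])))) ⟩
    links x ((ys ++ [ y ]) ++ zs ++ [ x ])
      ≡⟨ links-++ x (ys ++ [ y ]) (zs ++ [ x ]) ⟩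
    links x (ys ++ [ y ]) ++ links (last x (ys ++ [ y ])) (zs ++ [ x ])
      ≡⟨ cong (λ v → links x (ys ++ [ y ]) ++ links v (zs ++ [ x ])) (last-++ x ys y []) ⟩
    links x (ys ++ [ y ]) ++ links y (zs ++ [ x ]) ∎
    where open ≡-Reasoning

  cyclicLinks-rotate : ∀ x ys y zs → cyclicLinks y (zs ++ x ∷ ys) ↭ cyclicLinks x (ys ++ y ∷ zs)
  cyclicLinks-rotate x ys y zs = begin
    cyclicLinks y (zs ++ x ∷ ys)                    ≡⟨ cyclicLinks-++ y zs x ys ⟩
    links y (zs ++ [ x ]) ++ links x (ys ++ [ y ])  ↭⟨ ++-comm (links y (zs ++ [ x ])) _ ⟩
    links x (ys ++ [ y ]) ++ links y (zs ++ [ x ])  ≡⟨ cyclicLinks-++ x ys y zs ⟨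
    cyclicLinks x (ys ++ y ∷ zs)                    ∎
    where open PermutationReasoning

  map-proj₁-links-∷ʳ : ∀ x ys y → map proj₁ (links x (ys ++ [ y ])) ≡ x ∷ ys
  map-proj₁-links-∷ʳ x []       y = refl
  map-proj₁-links-∷ʳ x (z ∷ ys) y = cong (x ∷_) (map-proj₁-links-∷ʳ z ys y)

  cyclicLinks-↭⇒↭ : ∀ {x xs y ys} → cyclicLinks x xs ↭ cyclicLinks y ys → x ∷ xs ↭ y ∷ ys
  cyclicLinks-↭⇒↭ {x} {xs} {y} {ys} =
    subst₂ _↭_ (map-proj₁-links-∷ʳ x xs x) (map-proj₁-links-∷ʳ y ys y) ∘ map⁺ proj₁

  ∈-links⁻ : ∀ {a b} x xs → (a , b) ∈ links x xs →
             ∃₂ λ ys zs → xs ≡ ys ++ b ∷ zs × last x ys ≡ a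
  ∈-links⁻ x (y ∷ xs) (here refl) = [] , xs , refl , refl
  ∈-links⁻ x (y ∷ xs) (there ab∈) with ∈-links⁻ y xs ab∈
  ... | ys , zs , refl , eq = y ∷ ys , zs , refl , eq

  ∈-links-∷ʳ⁺ : ∀ {p} x ys y → p ∈ links x ys → p ∈ links x (ys ++ [ y ])
  ∈-links-∷ʳ⁺ x ys y p∈ = subst (_ ∈_) (sym (links-∷ʳ x ys y)) (∈-++⁺ˡ p∈)

  ∈-links-∷ʳ⁻ : ∀ {p} x ys y → p ∈ links x (ys ++ [ y ]) → p ∈ links x ys ⊎ p ≡ (last x ys , y)
  ∈-links-∷ʳ⁻ x ys y p∈ with ∈-++⁻ (links x ys) (subst (_ ∈_) (links-∷ʳ x ys y) p∈)
  ... | inj₁ p∈links = inj₁ p∈links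
  ... | inj₂ (here p≡) = inj₂ p≡

  All-links-∷ʳ⁺ : ∀ {P : A × A → Set} x ys y →
                  All P (links x ys) → P (last x ys , y) → All P (links x (ys ++ [ y ]))
  All-links-∷ʳ⁺ x ys y Ps P-last = subst (All _) (sym (links-∷ʳ x ys y)) (++⁺ Ps (P-last ∷ []))

  All-links-++⁻ : ∀ {P : A × A → Set} x ys zs →
                  All P (links x (ys ++ zs)) → All P (links x ys) × All P (links (last x ys) zs)
  All-links-++⁻ x ys zs = ++⁻ (links x ys) ∘ subst (All _) (links-++ x ys zs)

  rotateTo : ∀ {a b} x xs → (a , b) ∈ cyclicLinks x xs →
             ∃ λ zs → last b zs ≡ a × cyclicLinks b zs ↭ cyclicLinks x xs
  rotateTo x xs ab∈ with ∈-links-∷ʳ⁻ x xs x ab∈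
  ... | inj₂ refl = xs , refl , ↭-refl
  ... | inj₁ ab∈links with ∈-links⁻ x xs ab∈links
  ...   | ys , zs , refl , refl = zs ++ x ∷ ys , last-++ _ zs x ys , cyclicLinks-rotate x ys _ zs

  splitAfterLast : ∀ {P : A → Set} → Decidable P → ∀ x xs → Any P (x ∷ xs) →
    P (last x xs) ⊎
    ∃[ ys ] ∃[ y ] ∃[ zs ] (xs ≡ ys ++ y ∷ zs × P (last x ys) × All (¬_ ∘ P) (y ∷ zs))
  splitAfterLast P? x [] (here Px) = inj₁ Px
  splitAfterLast P? x (y ∷ xs) P-somewhere with any? P? (y ∷ xs)
  ... | yes P-later with splitAfterLast P? y xs P-later
  ...   | inj₁ P-last = inj₁ P-last
  ...   | inj₂ (ys , z , zs , refl , P-last , ¬P-after) = inj₂ (y ∷ ys , z , zs , refl , P-last , ¬P-after)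
  splitAfterLast P? x (y ∷ xs) (here Px)      | no ¬P-later =
    inj₂ ([] , y , xs , refl , Px , ¬Any⇒All¬ _ ¬P-later)
  splitAfterLast P? x (y ∷ xs) (there P-later) | no ¬P-later = ⊥-elim (¬P-later P-later)

  length-<-++∷ : ∀ ys (y : A) zs → length zs < length (ys ++ y ∷ zs)
  length-<-++∷ ys y zs = subst (length zs <_) (sym (length-++ ys)) (m≤n+m (suc (length zs)) (length ys))

  Unique-resp-↭ : ∀ {xs ys : List A} → xs ↭ ys → Unique xs → Unique ys
  Unique-resp-↭ = SetoidPermutation.Unique-resp-↭ (setoid A) ∘ ↭⇒↭ₛ

  lookup-injective : ∀ {xs : List A} → Unique xs → Injective _≡_ _≡_ (lookup xs)
  lookup-injective {x ∷ xs} (_    ∷ _) {zero}  {zero}  _  = refl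
  lookup-injective {x ∷ xs} (x∉xs ∷ _) {zero}  {suc j} eq = ⊥-elim (All.lookup x∉xs (∈-lookup j) eq)
  lookup-injective {x ∷ xs} (x∉xs ∷ _) {suc i} {zero}  eq = ⊥-elim (All.lookup x∉xs (∈-lookup i) (sym eq))
  lookup-injective {x ∷ xs} (_ ∷ unique) {suc i} {suc j} eq = cong suc (lookup-injective unique eq)

  ∈⇔lookup : ∀ {v : A} xs → v ∈ xs ⇔ ∃ λ i → lookup xs i ≡ v
  ∈⇔lookup {v} xs = mk⇔ to from
    where
    to : v ∈ xs → ∃ λ i → lookup xs i ≡ v
    to v∈ = index v∈ , sym (lookup-index v∈)
    from : (∃ λ i → lookup xs i ≡ v) → v ∈ xs
    from (i , refl) = ∈-lookup i

  ∈-tabulate⇔ : ∀ {m v} (f : Fin m → A) → v ∈ tabulate f ⇔ ∃ λ i → f i ≡ v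
  ∈-tabulate⇔ {v = v} f = mk⇔ to from
    where
    to : v ∈ tabulate f → ∃ λ i → f i ≡ v
    to v∈ with ∈-tabulate⁻ v∈
    ... | i , refl = i , refl
    from : (∃ λ i → f i ≡ v) → v ∈ tabulate f
    from (i , refl) = ∈-tabulate⁺ i

  ∈-++⇔ : ∀ {v : A} xs ys → v ∈ xs ++ ys ⇔ (v ∈ xs ⊎ v ∈ ys)
  ∈-++⇔ xs ys = mk⇔ (∈-++⁻ xs) [ ∈-++⁺ˡ , ∈-++⁺ʳ xs ]′

  tabulate-disjoint : ∀ {m m'} {f : Fin m → A} {g : Fin m' → A} →
                      (∀ i j → f i ≢ g j) → Disjoint (tabulate f) (tabulate g)
  tabulate-disjoint f≢g (v∈f , v∈g) with ∈-tabulate⁻ v∈f | ∈-tabulate⁻ v∈g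
  ... | i , refl | j , eq = f≢g i j eq

  links-tabulate : ∀ {m} (f : Fin (suc m) → A) →
                   links (f zero) (tabulate (f ∘ suc)) ≡ tabulate (λ i → f (inject₁ i) , f (suc i))
  links-tabulate {zero}  f = refl
  links-tabulate {suc m} f = cong ((f zero , f (suc zero)) ∷_) (links-tabulate (f ∘ suc))

  last-tabulate : ∀ {m} (f : Fin (suc m) → A) → last (f zero) (tabulate (f ∘ suc)) ≡ f (fromℕ m)
  last-tabulate {zero}  f = refl
  last-tabulate {suc m} f = last-tabulate (f ∘ suc)

  cyclicLinks-tabulate : ∀ {m} (f : Fin (suc m) → A) →
                         cyclicLinks (f zero) (tabulate (f ∘ suc)) ≡ tabulate (λ i → f i , f (csuc i))
  cyclicLinks-tabulate {m} f = begin
    cyclicLinks (f zero) (tabulate (f ∘ suc))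
      ≡⟨ links-∷ʳ (f zero) (tabulate (f ∘ suc)) (f zero) ⟩
    links (f zero) (tabulate (f ∘ suc)) ++ [ (last (f zero) (tabulate (f ∘ suc)) , f zero) ]
      ≡⟨ cong₂ (λ ps v → ps ++ [ (v , f zero) ]) (links-tabulate f) (last-tabulate f) ⟩
    tabulate (λ i → f (inject₁ i) , f (suc i)) ++ [ (f (fromℕ m) , f zero) ]
      ≡⟨ cong₂ (λ ps j → ps ++ [ (f (fromℕ m) , f j) ])
               (tabulate-cong (λ i → cong (λ j → f (inject₁ i) , f j) (sym (csuc-inject₁ i))))
               (sym (csuc-fromℕ m)) ⟩
    tabulate (λ i → f (inject₁ i) , f (csuc (inject₁ i))) ++ [ (f (fromℕ m) , f (csuc (fromℕ m))) ]
      ≡⟨ tabulate-∷ʳ (λ i → f i , f (csuc i)) ⟨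
    tabulate (λ i → f i , f (csuc i)) ∎
    where open ≡-Reasoning

  ∈-cyclicLinks-tabulate : ∀ {m} (f : Fin (suc m) → A) i →
                           (f i , f (csuc i)) ∈ cyclicLinks (f zero) (tabulate (f ∘ suc))
  ∈-cyclicLinks-tabulate f i =
    subst (_ ∈_) (sym (cyclicLinks-tabulate f)) (∈-tabulate⁺ {f = λ j → f j , f (csuc j)} i)

  links-lookup : ∀ x xs → links x xs ≡ tabulate (λ i → lookup (x ∷ xs) (inject₁ i) , lookup (x ∷ xs) (suc i))
  links-lookup x xs = trans (cong (links x) (sym (tabulate-lookup xs))) (links-tabulate (lookup (x ∷ xs)))

  last-lookup : ∀ x xs → lookup (x ∷ xs) (fromℕ (length xs)) ≡ last x xs
  last-lookup x xs = trans (sym (last-tabulate (lookup (x ∷ xs)))) (cong (last x) (tabulate-lookup xs))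

  cyclicLinks-lookup : ∀ x xs →
                       cyclicLinks x xs ≡ tabulate (λ i → lookup (x ∷ xs) i , lookup (x ∷ xs) (csuc i))
  cyclicLinks-lookup x xs =
    trans (cong (cyclicLinks x) (sym (tabulate-lookup xs))) (cyclicLinks-tabulate (lookup (x ∷ xs)))

module Insertion {A : Set} (arc : A → A → Bool) (Step : A → A → Set)
                 (arc⇒Step : ∀ {a b} → T (arc a b) → Step a b) where

  weight : A × A → ℕ
  weight (a , b) = if arc a b then 1 else 0

  weight-≤ : ∀ p → weight p ≤ 1
  weight-≤ (a , b) with arc a b
  ... | true  = s≤s z≤n
  ... | false = z≤n

  weight-arc : ∀ {a b} → T (arc a b) → weight (a , b) ≡ 1
  weight-arc {a} {b} a→b with arc a b
  ... | true = refl

  arcCount : List (A × A) → ℕ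
  arcCount = sum ∘ map weight

  arcCount-++ : ∀ ps qs → arcCount (ps ++ qs) ≡ arcCount ps + arcCount qs
  arcCount-++ ps qs = trans (cong sum (map-++ weight ps qs)) (sum-++ (map weight ps) (map weight qs))

  arcCount-↭ : ∀ {ps qs} → ps ↭ qs → arcCount ps ≡ arcCount qs
  arcCount-↭ = sum-↭ ∘ map⁺ weight

  count-tabulate : ∀ {m} (g : Fin m → A × A) → count (uncurry arc ∘ g) ≡ arcCount (tabulate g)
  count-tabulate {zero}  g = refl
  count-tabulate {suc m} g = cong (weight (g zero) +_) (count-tabulate (g ∘ suc))

  arcCount-links-∷ʳ : ∀ x ys y → arcCount (links x (ys ++ [ y ])) ≡ weight (last x ys , y) + arcCount (links x ys)
  arcCount-links-∷ʳ x ys y = begin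
    arcCount (links x (ys ++ [ y ]))                       ≡⟨ cong arcCount (links-∷ʳ x ys y) ⟩
    arcCount (links x ys ++ [ (last x ys , y) ])           ≡⟨ arcCount-++ (links x ys) _ ⟩
    arcCount (links x ys) + (weight (last x ys , y) + 0)   ≡⟨ cong (arcCount (links x ys) +_) (+-identityʳ _) ⟩
    arcCount (links x ys) + weight (last x ys , y)         ≡⟨ +-comm (arcCount (links x ys)) _ ⟩
    weight (last x ys , y) + arcCount (links x ys)         ∎
    where open ≡-Reasoning

  arcCount-links-∷ʳ-≤ : ∀ x ys y → arcCount (links x (ys ++ [ y ])) ≤ suc (arcCount (links x ys))
  arcCount-links-∷ʳ-≤ x ys y = subst (_≤ _) (sym (arcCount-links-∷ʳ x ys y)) (+-monoˡ-≤ _ (weight-≤ _))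

  arcCount-links-∷ʳ-arc : ∀ x ys y → T (arc (last x ys) y) →
                          arcCount (links x (ys ++ [ y ])) ≡ suc (arcCount (links x ys))
  arcCount-links-∷ʳ-arc x ys y last→y =
    trans (arcCount-links-∷ʳ x ys y) (cong (_+ arcCount (links x ys)) (weight-arc last→y))

  Partner : List (A × A) → A → A → Set
  Partner L x y = ∃₂ λ a b → (a , b) ∈ L × T (arc a x) × T (arc y b)

  Partnered : List (A × A) → A → List A → Set
  Partnered L x []       = Partner L x x
  Partnered L x (y ∷ ys) = (Partner L x x ⊎ Partner L x y) × Partnered L y ys

  firstPartner : ∀ {L} x xs → Partnered L x xs →
                 ∃₂ λ a b → (a , b) ∈ L × T (arc a x) × Any (λ z → T (arc z b)) (x ∷ xs)
  firstPartner x []       (a , b , ab∈ , a→x , x→b)          = a , b , ab∈ , a→x , here x→b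
  firstPartner x (y ∷ ys) (inj₁ (a , b , ab∈ , a→x , x→b) , _) = a , b , ab∈ , a→x , here x→b
  firstPartner x (y ∷ ys) (inj₂ (a , b , ab∈ , a→x , y→b) , _) = a , b , ab∈ , a→x , there (here y→b)

  Partnered-suffix : ∀ {L} x ys y zs → Partnered L x (ys ++ y ∷ zs) → Partnered L y zs
  Partnered-suffix x []       y zs (_ , partnered) = partnered
  Partnered-suffix x (w ∷ ys) y zs (_ , partnered) = Partnered-suffix w ys y zs partnered

  Partner-mono : ∀ {L L' x y} → (∀ {a b} → (a , b) ∈ L → T (arc y b) → (a , b) ∈ L') →
                 Partner L x y → Partner L' x y
  Partner-mono keep (a , b , ab∈ , a→x , y→b) = a , b , keep ab∈ y→b , a→x , y→b

  Partnered-mono : ∀ {L L'} x xs →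
                   (∀ {a b} → (a , b) ∈ L → Any (λ z → T (arc z b)) (x ∷ xs) → (a , b) ∈ L') →
                   Partnered L x xs → Partnered L' x xs
  Partnered-mono x []       keep = Partner-mono λ ab∈ → keep ab∈ ∘ here
  Partnered-mono x (y ∷ ys) keep (partner , partnered) =
    Sum.map (Partner-mono λ ab∈ → keep ab∈ ∘ here)
            (Partner-mono λ ab∈ → keep ab∈ ∘ there ∘ here) partner ,
    Partnered-mono y ys (λ ab∈ → keep ab∈ ∘ there) partnered

  Partnered-tabulate : ∀ {L r} (u : Fin (suc r) → A) →
    (∀ (i : Fin r) → Partner L (u (inject₁ i)) (u (inject₁ i)) ⊎ Partner L (u (inject₁ i)) (u (suc i))) →
    Partner L (u (fromℕ r)) (u (fromℕ r)) → Partnered L (u zero) (tabulate (u ∘ suc))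
  Partnered-tabulate {r = zero}  u partners final-partner = final-partner
  Partnered-tabulate {r = suc r} u partners final-partner =
    partners zero , Partnered-tabulate (u ∘ suc) (partners ∘ suc) final-partner

  Steps : List (A × A) → Set
  Steps = All (uncurry Step)

  record Merged (x : A) (xs : List A) (c : A) (cs : List A) : Set where
    field
      cycleHead : A
      cycleTail : List A
      steps     : Steps (cyclicLinks cycleHead cycleTail)
      vertices  : cycleHead ∷ cycleTail ↭ (x ∷ xs) ++ (c ∷ cs)
      longer    : arcCount (links x xs) + arcCount (cyclicLinks c cs) < arcCount (cyclicLinks cycleHead cycleTail)

  open Merged

  insert : ∀ {a b x xs c cs} → (a , b) ∈ cyclicLinks c cs → T (arc a x) → T (arc (last x xs) b) →
           Steps (links x xs) → Steps (cyclicLinks c cs) →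
           Σ (Merged x xs c cs) λ M →
             ∀ {a' b'} → (a' , b') ∈ cyclicLinks c cs → b' ≢ b →
                         (a' , b') ∈ cyclicLinks (cycleHead M) (cycleTail M)
  insert {b = b} {x} {xs} {c} {cs} ab∈ a→x last→b path-steps cycle-steps with rotateTo c cs ab∈
  ... | zs , refl , rotation = M , kept
    where
    new-links : cyclicLinks x (xs ++ b ∷ zs) ≡ links x (xs ++ [ b ]) ++ links b (zs ++ [ x ])
    new-links = cyclicLinks-++ x xs b zs

    M : Merged x xs c cs
    M .cycleHead = x
    M .cycleTail = xs ++ b ∷ zs
    M .steps     = subst Steps (sym new-links) (++⁺
      (All-links-∷ʳ⁺ x xs b path-steps (arc⇒Step last→b))
      (All-links-∷ʳ⁺ b zs x (proj₁ (All-links-++⁻ b zs [ b ] (All-resp-↭ (↭-sym rotation) cycle-steps)))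
                            (arc⇒Step a→x)))
    M .vertices  = ++⁺ˡ (x ∷ xs) (cyclicLinks-↭⇒↭ rotation)
    M .longer    = begin-strict
      arcCount (links x xs) + arcCount (cyclicLinks c cs)
        ≡⟨ cong (arcCount (links x xs) +_) (arcCount-↭ (↭-sym rotation)) ⟩
      arcCount (links x xs) + arcCount (links b (zs ++ [ b ]))
        ≤⟨ +-monoʳ-≤ (arcCount (links x xs)) (arcCount-links-∷ʳ-≤ b zs b) ⟩
      arcCount (links x xs) + suc (arcCount (links b zs))
        <⟨ n<1+n _ ⟩
      suc (arcCount (links x xs)) + suc (arcCount (links b zs))
        ≡⟨ cong₂ _+_ (arcCount-links-∷ʳ-arc x xs b last→b) (arcCount-links-∷ʳ-arc b zs x a→x) ⟨
      arcCount (links x (xs ++ [ b ])) + arcCount (links b (zs ++ [ x ]))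
        ≡⟨ trans (cong arcCount new-links) (arcCount-++ (links x (xs ++ [ b ])) (links b (zs ++ [ x ]))) ⟨
      arcCount (cyclicLinks x (xs ++ b ∷ zs)) ∎
      where open ≤-Reasoning

    kept : ∀ {a' b'} → (a' , b') ∈ cyclicLinks c cs → b' ≢ b → (a' , b') ∈ cyclicLinks x (xs ++ b ∷ zs)
    kept a'b'∈ b'≢b with ∈-links-∷ʳ⁻ b zs b (∈-resp-↭ (↭-sym rotation) a'b'∈)
    ... | inj₁ a'b'∈zs =
      subst (_ ∈_) (sym new-links) (∈-++⁺ʳ (links x (xs ++ [ b ])) (∈-links-∷ʳ⁺ b zs x a'b'∈zs))
    ... | inj₂ refl    = ⊥-elim (b'≢b refl)

  Merged-++ : ∀ {x xs y ys c cs} (M : Merged x xs c cs) → Merged y ys (cycleHead M) (cycleTail M) →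
              Merged x (xs ++ y ∷ ys) c cs
  Merged-++ {x} {xs} {y} {ys} {c} {cs} M N = record
    { cycleHead = cycleHead N
    ; cycleTail = cycleTail N
    ; steps     = steps N
    ; vertices  = all-vertices
    ; longer    = longer-than-both
    }
    where
    all-vertices : cycleHead N ∷ cycleTail N ↭ (x ∷ xs ++ y ∷ ys) ++ (c ∷ cs)
    all-vertices = begin
      cycleHead N ∷ cycleTail N                ↭⟨ vertices N ⟩
      (y ∷ ys) ++ (cycleHead M ∷ cycleTail M)  ↭⟨ ++⁺ˡ (y ∷ ys) (vertices M) ⟩
      (y ∷ ys) ++ (x ∷ xs) ++ (c ∷ cs)         ↭⟨ shifts (y ∷ ys) (x ∷ xs) ⟩
      (x ∷ xs) ++ (y ∷ ys) ++ (c ∷ cs)         ≡⟨ ++-assoc (x ∷ xs) (y ∷ ys) (c ∷ cs) ⟨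
      ((x ∷ xs) ++ (y ∷ ys)) ++ (c ∷ cs)       ∎
      where open PermutationReasoning

    P Q C : ℕ
    P = arcCount (links x xs)
    Q = arcCount (links y ys)
    C = arcCount (cyclicLinks c cs)

    rearrange : ∀ p q c → p + suc q + c ≡ q + suc (p + c)
    rearrange = solve-∀

    longer-than-both : arcCount (links x (xs ++ y ∷ ys)) + C < arcCount (cyclicLinks (cycleHead N) (cycleTail N))
    longer-than-both = begin-strict
      arcCount (links x (xs ++ y ∷ ys)) + C
        ≡⟨ cong (λ ps → arcCount ps + C) (links-++ x xs (y ∷ ys)) ⟩
      arcCount (links x xs ++ (last x xs , y) ∷ links y ys) + C
        ≡⟨ cong (_+ C) (arcCount-++ (links x xs) _) ⟩
      P + (weight (last x xs , y) + Q) + C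
        ≤⟨ +-monoˡ-≤ C (+-monoʳ-≤ P (+-monoˡ-≤ Q (weight-≤ _))) ⟩
      P + suc Q + C
        ≡⟨ rearrange P Q C ⟩
      Q + suc (P + C)
        ≤⟨ +-monoʳ-≤ Q (longer M) ⟩
      Q + arcCount (cyclicLinks (cycleHead M) (cycleTail M))
        <⟨ longer N ⟩
      arcCount (cyclicLinks (cycleHead N) (cycleTail N)) ∎
      where open ≤-Reasoning

  merge : ∀ {x xs c cs} → Acc _<_ (length xs) → Steps (links x xs) → Steps (cyclicLinks c cs) →
          Partnered (cyclicLinks c cs) x xs → Merged x xs c cs
  merge {x} {xs} (acc shorter) path-steps cycle-steps partnered
    with firstPartner x xs partnered
  ... | a , b , ab∈ , a→x , reaches-b
    with splitAfterLast (λ z → T? (arc z b)) x xs reaches-b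
  ... | inj₁ last→b = proj₁ (insert ab∈ a→x last→b path-steps cycle-steps)
  ... | inj₂ (ys , y , zs , refl , last→b , misses-b)
    with All-links-++⁻ x ys (y ∷ zs) path-steps
  ... | prefix-steps , _ ∷ rest-steps
    with insert ab∈ a→x last→b prefix-steps cycle-steps
  ... | M , keeps = Merged-++ M (merge (shorter (length-<-++∷ ys y zs)) rest-steps (steps M) rest-partnered)
    where
    -- No vertex of y ∷ zs has an arc into b, so their partners avoid (a , b),
    -- the only link that the insertion destroys.
    rest-partnered : Partnered (cyclicLinks (cycleHead M) (cycleTail M)) y zs
    rest-partnered = Partnered-mono y zs
      (λ a'b'∈ reaches-b' → keeps a'b'∈ λ { refl → All¬⇒¬Any misses-b reaches-b' })
      (Partnered-suffix x ys y zs partnered)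

module _ {n k : ℕ} (D : SMD n k) where
  open SMD D
  open Insertion arc (Step D) inj₁

  pathLen-tabulate : ∀ {m} (f : Fin (suc m) → Fin n) →
                     pathLen D f ≡ arcCount (links (f zero) (tabulate (f ∘ suc)))
  pathLen-tabulate f =
    trans (count-tabulate (λ i → f (inject₁ i) , f (suc i))) (cong arcCount (sym (links-tabulate f)))

  cycLen-tabulate : ∀ {m} (f : Fin (suc m) → Fin n) →
                    cycLen D f ≡ arcCount (cyclicLinks (f zero) (tabulate (f ∘ suc)))
  cycLen-tabulate f = trans (count-tabulate (λ i → f i , f (csuc i))) (cong arcCount (sym (cyclicLinks-tabulate f)))

  cycLen-lookup : ∀ z zs → cycLen D (lookup (z ∷ zs)) ≡ arcCount (cyclicLinks z zs)
  cycLen-lookup z zs =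
    trans (count-tabulate (λ i → lookup (z ∷ zs) i , lookup (z ∷ zs) (csuc i)))
          (cong arcCount (sym (cyclicLinks-lookup z zs)))

  GPath-steps : ∀ {m} {f : Fin (suc m) → Fin n} → IsGPath D f → Steps (links (f zero) (tabulate (f ∘ suc)))
  GPath-steps {f = f} (_ , steps) = subst Steps (sym (links-tabulate f)) (tabulate⁺ steps)

  GCycle-steps : ∀ {m} {f : Fin (suc m) → Fin n} → IsGCycle D f →
                 Steps (cyclicLinks (f zero) (tabulate (f ∘ suc)))
  GCycle-steps {f = f} (inj₁ (_ , _ , arcs)) =
    subst Steps (sym (cyclicLinks-tabulate f)) (tabulate⁺ (inj₁ ∘ arcs))
  GCycle-steps {f = f} (inj₂ (path , closing)) =
    All-links-∷ʳ⁺ (f zero) _ (f zero) (GPath-steps path)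
      (inj₂ (subst (λ v → part v ≡ part (f zero)) (sym (last-tabulate f)) closing))

  GCycle-injective : ∀ {m} {f : Fin (suc m) → Fin n} → IsGCycle D f → Injective _≡_ _≡_ f
  GCycle-injective (inj₁ (injective , _))       = injective
  GCycle-injective (inj₂ ((injective , _) , _)) = injective

  HasPartner⇒Partner : ∀ {m x y} {c : Fin (suc m) → Fin n} → HasPartner D x y c →
                       Partner (cyclicLinks (c zero) (tabulate (c ∘ suc))) x y
  HasPartner⇒Partner {c = c} (i , ci→x , y→ci⁺) =
    c i , c (csuc i) , ∈-cyclicLinks-tabulate c i , ci→x , y→ci⁺

  no-loop : ∀ v → ¬ T (arc v v)
  no-loop v = subst T (indep v v refl)

  arc-cycle-nontrivial : ∀ {y} ys → All (T ∘ uncurry arc) (cyclicLinks y ys) → 1 ≤ length ys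
  arc-cycle-nontrivial {y} [] (y→y ∷ []) = ⊥-elim (no-loop y y→y)
  arc-cycle-nontrivial (_ ∷ _) _          = s≤s z≤n

  toGCycle : ∀ {y ys} → Steps (cyclicLinks y ys) → Unique (y ∷ ys) →
            ∃₂ λ z zs → cyclicLinks z zs ↭ cyclicLinks y ys × IsGCycle D (lookup (z ∷ zs))
  toGCycle {y} {ys} steps unique with all? (T? ∘ uncurry arc) (cyclicLinks y ys)
  ... | yes arcs = y , ys , ↭-refl , inj₁ (lookup-injective unique , arc-cycle-nontrivial ys arcs ,
                     tabulate⁻ (subst (All _) (cyclicLinks-lookup y ys) arcs))
  ... | no ¬arcs with find (¬All⇒Any¬ (T? ∘ uncurry arc) (cyclicLinks y ys) ¬arcs)
  ...   | (a , b) , ab∈ , ¬a→b with All.lookup steps ab∈ | rotateTo y ys ab∈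
  ...     | inj₁ a→b       | _                  = ⊥-elim (¬a→b a→b)
  ...     | inj₂ same-part | zs , refl , rotation =
    b , zs , rotation , inj₂ ((lookup-injective b∷zs-unique , b∷zs-steps) , closing)
    where
    b∷zs-unique : Unique (b ∷ zs)
    b∷zs-unique = Unique-resp-↭ (cyclicLinks-↭⇒↭ (↭-sym rotation)) unique
    b∷zs-steps : ∀ j → Step D (lookup (b ∷ zs) (inject₁ j)) (lookup (b ∷ zs) (suc j))
    b∷zs-steps = tabulate⁻ (subst Steps (links-lookup b zs)
                   (proj₁ (All-links-++⁻ b zs [ b ] (All-resp-↭ (↭-sym rotation) steps))))
    closing : part (lookup (b ∷ zs) (fromℕ (length zs))) ≡ part b
    closing = trans (cong part (last-lookup b zs)) same-part

  Merged⇒GCycle : ∀ {x xs c cs} → Unique ((x ∷ xs) ++ (c ∷ cs)) → Merged x xs c cs →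
    ∃₂ λ z zs → IsGCycle D (lookup (z ∷ zs)) × z ∷ zs ↭ (x ∷ xs) ++ (c ∷ cs)
              × arcCount (links x xs) + arcCount (cyclicLinks c cs) < cycLen D (lookup (z ∷ zs))
  Merged⇒GCycle unique M with toGCycle (Merged.steps M) (Unique-resp-↭ (↭-sym (Merged.vertices M)) unique)
  ... | z , zs , rotation , z-cycle =
    z , zs , z-cycle , ↭-trans (cyclicLinks-↭⇒↭ rotation) (Merged.vertices M) ,
    subst (_ <_) (sym (trans (cycLen-lookup z zs) (arcCount-↭ rotation))) (Merged.longer M)

lemma2p2 : ∀ {n k : ℕ} (D : SMD n k) {r m : ℕ}
    (u : Fin (suc r) → Fin n) (c : Fin (suc m) → Fin n) →
    IsGPath D u →
    IsGCycle D c →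
    (∀ i j → u i ≢ c j) →
    (∀ (i : Fin r) → HasPartner D (u (inject₁ i)) (u (inject₁ i)) c ⊎ HasPartner D (u (inject₁ i)) (u (suc i)) c) →
    HasPartner D (u (fromℕ r)) (u (fromℕ r)) c →
    ∃₂ λ (m' : ℕ) (c' : Fin (suc m') → Fin n) →
      IsGCycle D c'
      × (∀ v → (∃ λ i → c' i ≡ v) ⇔ ((∃ λ i → u i ≡ v) ⊎ (∃ λ j → c j ≡ v)))
      × (pathLen D u + cycLen D c + 1 ≤ cycLen D c')
lemma2p2 D u c u-path c-cycle disjoint partners final-partner =
  let z , zs , z-cycle , vertices , longer = Merged⇒GCycle D unique merged
  in  length zs , lookup (z ∷ zs) , z-cycle , same-vertices vertices , lengths longer
  where
  open Insertion (SMD.arc D) (Step D) inj₁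

  unique : Unique (tabulate u ++ tabulate c)
  unique = Unique.++⁺ (Unique.tabulate⁺ (proj₁ u-path)) (Unique.tabulate⁺ (GCycle-injective D c-cycle))
                      (tabulate-disjoint disjoint)

  partnered : Partnered (cyclicLinks (c zero) (tabulate (c ∘ suc))) (u zero) (tabulate (u ∘ suc))
  partnered = Partnered-tabulate u (Sum.map (HasPartner⇒Partner D) (HasPartner⇒Partner D) ∘ partners)
                                   (HasPartner⇒Partner D final-partner)

  merged : Merged (u zero) (tabulate (u ∘ suc)) (c zero) (tabulate (c ∘ suc))
  merged = merge (<-wellFounded _) (GPath-steps D u-path) (GCycle-steps D c-cycle) partnered

  same-vertices : ∀ {zs} → zs ↭ tabulate u ++ tabulate c →
                  ∀ v → (∃ λ i → lookup zs i ≡ v) ⇔ ((∃ λ i → u i ≡ v) ⊎ (∃ λ j → c j ≡ v))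
  same-vertices {zs} vertices v =
    ⇔.trans (⇔.sym (∈⇔lookup zs))
   (⇔.trans (mk⇔ (∈-resp-↭ vertices) (∈-resp-↭ (↭-sym vertices)))
   (⇔.trans (∈-++⇔ (tabulate u) (tabulate c)) (∈-tabulate⇔ u ⊎-⇔ ∈-tabulate⇔ c)))

  lengths : ∀ {ℓ} →
            arcCount (links (u zero) (tabulate (u ∘ suc))) + arcCount (cyclicLinks (c zero) (tabulate (c ∘ suc))) < ℓ →
            pathLen D u + cycLen D c + 1 ≤ ℓ
  lengths {ℓ} longer rewrite pathLen-tabulate D u | cycLen-tabulate D c = subst (_≤ ℓ) (+-comm 1 _) longer
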